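{- Let $G=(V,E)$ be a connected subcubic graph admitting a strong clique $C$ of size $3$. If there exists a strong clique $C'$ in $G$ such that $C\neq C'$ and $C\cap C'\neq\emptyset$, then $G$ is localizable if and only if $G\cong\overline{P_2+P_3}$.
   Context: All graphs are finite, simple and undirected. A graph is subcubic if its maximum degree is at most $3$. A clique is strong if it intersects every maximal independent set; a graph is localizable if its vertex set can be partitioned into strong cliques. $P_n$ is the $n$-vertex path, $P_2+P_3$ the disjoint union of $P_2$ and $P_3$, and $\overline{\,\cdot\,}$ denotes the complement graph. -}

module Defs where

open import Data.Nat using (ℕ; zero; suc; _≤_; _≡ᵇ_)
open import Data.Bool using (Bool; true; false; not; _∧_; _∨_)
open import Data.Bool.Properties using (∨-comm)
open import Data.Fin using (Fin; toℕ; splitAt)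
open import Data.Fin.Subset using (Subset; _∈_; _∉_; _⊆_; ∣_∣)
open import Data.Vec using (tabulate)
open import Data.Sum using (inj₁; inj₂)
open import Data.Product using (Σ; ∃; _×_; _,_)
open import Function.Bundles using (_⤖_; Bijection)
open import Relation.Binary.PropositionalEquality using (_≡_; _≢_; refl; cong)

record Graph (n : ℕ) : Set where
  field
    adj    : Fin n → Fin n → Bool
    sym    : ∀ i j → adj i j ≡ adj j i
    irrefl : ∀ i → adj i i ≡ false
open Graph public

module _ {n : ℕ} (G : Graph n) where

  N : Fin n → Subset n
  N v = tabulate (adj G v)

  Subcubic : Set
  Subcubic = ∀ v → ∣ N v ∣ ≤ 3

  data Reach (u : Fin n) : Fin n → Set where
    here : Reach u u
    step : ∀ {v w} → Reach u v → adj G v w ≡ true → Reach u w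

  Connected : Set
  Connected = ∀ u v → Reach u v

  IsClique : Subset n → Set
  IsClique C = ∀ {u v} → u ∈ C → v ∈ C → u ≢ v → adj G u v ≡ true

  IsIndependent : Subset n → Set
  IsIndependent S = ∀ {u v} → u ∈ S → v ∈ S → adj G u v ≡ false

  IsMaximalIndependent : Subset n → Set
  IsMaximalIndependent S =
    IsIndependent S × (∀ T → IsIndependent T → S ⊆ T → T ⊆ S)

  IsStrongClique : Subset n → Set
  IsStrongClique C =
    IsClique C × (∀ I → IsMaximalIndependent I → ∃ λ v → v ∈ C × v ∈ I)

  -- V can be partitioned into strong cliques: a labelling of the vertices
  -- whose (nonempty) label classes are all strong cliques
  classOf : (Fin n → Fin n) → Fin n → Subset n
  classOf f v = tabulate (λ u → toℕ (f u) ≡ᵇ toℕ (f v))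

  Localizable : Set
  Localizable = Σ (Fin n → Fin n) λ f → ∀ v → IsStrongClique (classOf f v)

_≅_ : ∀ {n m} → Graph n → Graph m → Set
_≅_ {n} {m} G H =
  Σ (Fin n ⤖ Fin m) λ σ →
    ∀ i j → adj H (Bijection.to σ i) (Bijection.to σ j) ≡ adj G i j

private
  ≡ᵇ-suc : ∀ k → (k ≡ᵇ suc k) ≡ false
  ≡ᵇ-suc zero = refl
  ≡ᵇ-suc (suc k) = ≡ᵇ-suc k

  ≡ᵇ-refl : ∀ k → (k ≡ᵇ k) ≡ true
  ≡ᵇ-refl zero = refl
  ≡ᵇ-refl (suc k) = ≡ᵇ-refl k

  ≡ᵇ-sym : ∀ a b → (a ≡ᵇ b) ≡ (b ≡ᵇ a)
  ≡ᵇ-sym zero zero = refl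
  ≡ᵇ-sym zero (suc b) = refl
  ≡ᵇ-sym (suc a) zero = refl
  ≡ᵇ-sym (suc a) (suc b) = ≡ᵇ-sym a b

P : (n : ℕ) → Graph n
P n = record
  { adj = λ i j → (toℕ i ≡ᵇ suc (toℕ j)) ∨ (toℕ j ≡ᵇ suc (toℕ i))
  ; sym = λ i j → ∨-comm (toℕ i ≡ᵇ suc (toℕ j)) (toℕ j ≡ᵇ suc (toℕ i))
  ; irrefl = λ i → pf (toℕ i)
  }
  where
    pf : ∀ k → ((k ≡ᵇ suc k) ∨ (k ≡ᵇ suc k)) ≡ false
    pf k rewrite ≡ᵇ-suc k = refl

_⊕_ : ∀ {m n} → Graph m → Graph n → Graph (m Data.Nat.+ n)
_⊕_ {m} {n} G H = record { adj = a ; sym = s ; irrefl = ir }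
  where
    a : Fin (m Data.Nat.+ n) → Fin (m Data.Nat.+ n) → Bool
    a i j with splitAt m i | splitAt m j
    ... | inj₁ x | inj₁ y = adj G x y
    ... | inj₂ x | inj₂ y = adj H x y
    ... | inj₁ _ | inj₂ _ = false
    ... | inj₂ _ | inj₁ _ = false
    s : ∀ i j → a i j ≡ a j i
    s i j with splitAt m i | splitAt m j
    ... | inj₁ x | inj₁ y = sym G x y
    ... | inj₂ x | inj₂ y = sym H x y
    ... | inj₁ _ | inj₂ _ = refl
    ... | inj₂ _ | inj₁ _ = refl
    ir : ∀ i → a i i ≡ false
    ir i with splitAt m i
    ... | inj₁ x = irrefl G x
    ... | inj₂ x = irrefl H x

co : ∀ {n} → Graph n → Graph n
co {n} G = record
  { adj = λ i j → not (adj G i j) ∧ not (toℕ i ≡ᵇ toℕ j)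
  ; sym = λ i j → s i j
  ; irrefl = λ i → ir i
  }
  where
    s : ∀ i j → (not (adj G i j) ∧ not (toℕ i ≡ᵇ toℕ j))
              ≡ (not (adj G j i) ∧ not (toℕ j ≡ᵇ toℕ i))
    s i j rewrite sym G i j | ≡ᵇ-sym (toℕ i) (toℕ j) = refl
    ir : ∀ i → (not (adj G i i) ∧ not (toℕ i ≡ᵇ toℕ i)) ≡ false
    ir i rewrite ≡ᵇ-refl (toℕ i) | irrefl G i = refl

-- If G ≅ H = complement of P₂ + P₃, the partition {0,2,4}, {1,3} of H is a localization
-- (checked by exhaustive search), and localizability transfers along isomorphisms.
-- Conversely, for localizable G the basic tool is that a strong clique contains, for every
-- independent set I, a vertex non-adjacent to all of I (extend I to a maximal one). Let
-- x ∈ C ∩ C' and w ∈ C' ∖ C. Subcubicity gives N(x) = (C − x) ∪ {w}, and the strongness of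
-- C, C' and of the classes of a localization force enough edges and non-edges that, according
-- to the adjacencies of w to C − x, either five vertices closed under adjacency span a copy of
-- H (which is then all of G, by connectivity), or some class misses a maximal independent set.

module Submission where

open import Defs hiding (sym)
open import Data.Bool using (true; false)
open import Data.Bool.Properties using (T-≡; ¬-not) renaming (_≟_ to _≟ᵇ_)
open import Data.Empty using (⊥; ⊥-elim)
open import Data.Fin using (Fin; toℕ; zero; suc)
open import Data.Fin.Patterns using (0F; 1F; 2F; 3F; 4F)
open import Data.Fin.Properties using (_≟_; any?; all?; toℕ-injective)
open import Data.Fin.Subset
  using (Subset; inside; outside; _∈_; _∉_; _⊆_; ∣_∣; Nonempty; _∩_; _∪_; ⁅_⁆; _-_)
  renaming (⊥ to ∅)
open import Data.Fin.Subset.Properties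
  using (_∈?_; ∉⊥; x∈⁅x⁆; x∈⁅y⁆⇒x≡y; x∈p∪q⁺; x∈p∪q⁻; x∈p∩q⁻; p─q⊆p; x∈p∧x≢y⇒x∈p-y;
         x∈p⇒∣p-x∣<∣p∣; p─⊥≡p; ∣p∣≤n; p⊂q⇒∣p∣<∣q∣; nonempty?; Empty-unique; ∣⊥∣≡0;
         anySubset?; ⊆-antisym)
open import Data.List using (List; []; _∷_; length; map; foldr)
open import Data.List.Membership.Propositional using () renaming (_∈_ to _∈ₗ_; _∉_ to _∉ₗ_)
open import Data.List.Membership.Propositional.Properties using (∈-map⁻)
open import Data.List.Relation.Unary.All as All using (All; []; _∷_)
open import Data.List.Relation.Unary.All.Properties using (¬Any⇒All¬)
open import Data.List.Relation.Unary.AllPairs using (AllPairs; []; _∷_)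
open import Data.List.Relation.Unary.Any as Any using (here; there)
open import Data.List.Relation.Unary.Unique.Propositional using (Unique)
open import Data.Nat using (ℕ; zero; suc; _+_; _≤_; _<_; z≤n; s≤s)
open import Data.Nat.Properties
  using (≡ᵇ⇒≡; ≡⇒≡ᵇ; ≤-trans; ≤-reflexive; <-irrefl; <⇒≱; m≤n⇒m≤1+n; m≤m+n; +-suc;
         +-monoʳ-≤; <-≤-trans; ≤-<-trans)
open import Data.Product using (∃; ∃₂; _×_; _,_; proj₁; proj₂)
open import Data.Sum using (_⊎_; inj₁; inj₂)
open import Data.Vec using (_∷_; tabulate; lookup)
import Data.Vec as Vec
open import Data.Vec.Properties using ([]=⇒lookup; lookup⇒[]=; lookup∘tabulate)
open import Function using (_∘_; id)
open import Function.Bundles using (_⇔_; mk⇔; Equivalence; Inverse; mk↔ₛ′)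
open import Function.Properties.Bijection using (⤖⇒↔)
open import Function.Properties.Inverse using (↔⇒⤖)
open import Relation.Nullary using (¬_)
open import Relation.Nullary.Decidable
  using (Dec; yes; no; _×-dec_; _⊎-dec_; _→-dec_; ¬?; map′; decidable-stable; from-yes)
open import Relation.Binary.PropositionalEquality
  using (_≡_; _≢_; refl; sym; trans; cong; cong₂; subst; ≢-sym)

_∈ₗ?_ : ∀ {n} (x : Fin n) xs → Dec (x ∈ₗ xs)
x ∈ₗ? xs = Any.any? (x ≟_) xs

x∉p-x : ∀ {n} (p : Subset n) x → x ∉ p - x
x∉p-x (_ ∷ p) zero    ()
x∉p-x (_ ∷ p) (suc x) (Vec.there x∈p-x) = x∉p-x p x x∈p-x

∣p∣≡suc∣p-x∣ : ∀ {n} {p : Subset n} {x} → x ∈ p → ∣ p ∣ ≡ suc ∣ p - x ∣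
∣p∣≡suc∣p-x∣ {p = inside ∷ p}  {zero}  Vec.here      = cong (suc ∘ ∣_∣) (sym (p─⊥≡p p))
∣p∣≡suc∣p-x∣ {p = outside ∷ p} {suc x} (Vec.there m) = ∣p∣≡suc∣p-x∣ m
∣p∣≡suc∣p-x∣ {p = inside ∷ p}  {suc x} (Vec.there m) = cong suc (∣p∣≡suc∣p-x∣ m)

module _ {n : ℕ} where

  length≤∣p∣ : ∀ {xs} {p : Subset n} → Unique xs → All (_∈ p) xs → length xs ≤ ∣ p ∣
  length≤∣p∣ {[]}         _             _            = z≤n
  length≤∣p∣ {x ∷ xs} {p} (x∉xs ∷ uniq) (x∈p ∷ xs⊆p) =
    ≤-trans (s≤s (length≤∣p∣ uniq xs⊆p-x)) (x∈p⇒∣p-x∣<∣p∣ x∈p)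
    where
    xs⊆p-x : All (_∈ p - x) xs
    xs⊆p-x = All.zipWith (λ (x≢v , v∈p) → x∈p∧x≢y⇒x∈p-y v∈p (≢-sym x≢v)) (x∉xs , xs⊆p)

  ∣p∣≤length : ∀ xs {p : Subset n} → (∀ {v} → v ∈ p → v ∈ₗ xs) → ∣ p ∣ ≤ length xs
  ∣p∣≤length [] {p} p⊆[] with nonempty? p
  ... | yes (v , v∈p) with () ← p⊆[] v∈p
  ... | no empty = ≤-reflexive (trans (cong ∣_∣ (Empty-unique empty)) (∣⊥∣≡0 n))
  ∣p∣≤length (x ∷ xs) {p} p⊆x∷xs with x ∈? p
  ... | yes x∈p = subst (_≤ suc (length xs)) (sym (∣p∣≡suc∣p-x∣ x∈p)) (s≤s (∣p∣≤length xs p-x⊆xs))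
    where
    p-x⊆xs : ∀ {v} → v ∈ p - x → v ∈ₗ xs
    p-x⊆xs {v} v∈p-x with p⊆x∷xs (p─q⊆p p ⁅ x ⁆ v∈p-x)
    ... | here refl = ⊥-elim (x∉p-x p x v∈p-x)
    ... | there v∈xs = v∈xs
  ... | no x∉p = m≤n⇒m≤1+n (∣p∣≤length xs p⊆xs)
    where
    p⊆xs : ∀ {v} → v ∈ p → v ∈ₗ xs
    p⊆xs v∈p with p⊆x∷xs v∈p
    ... | here refl = ⊥-elim (x∉p v∈p)
    ... | there v∈xs = v∈xs

  member-outside : ∀ xs {p : Subset n} → length xs < ∣ p ∣ → ∃ λ v → v ∈ p × v ∉ₗ xs
  member-outside xs {p} xs<p with any? (λ v → v ∈? p ×-dec ¬? (v ∈ₗ? xs))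
  ... | yes found = found
  ... | no none = ⊥-elim (<⇒≱ xs<p (∣p∣≤length xs p⊆xs))
    where
    p⊆xs : ∀ {v} → v ∈ p → v ∈ₗ xs
    p⊆xs {v} v∈p = decidable-stable (v ∈ₗ? xs) (λ v∉xs → none (v , v∈p , v∉xs))

  ∣p∣≡3⇒members : ∀ {p : Subset n} {x} → ∣ p ∣ ≡ 3 → x ∈ p →
    ∃₂ λ y z → y ∈ p × z ∈ p × Unique (x ∷ y ∷ z ∷ []) ×
      (∀ {v} → v ∈ p → v ∈ₗ x ∷ y ∷ z ∷ [])
  ∣p∣≡3⇒members {p} {x} ∣p∣≡3 x∈p
    with member-outside (x ∷ []) (subst (1 <_) (sym ∣p∣≡3) (s≤s (s≤s z≤n)))
  ... | y , y∈p , y∉x with member-outside (x ∷ y ∷ []) (subst (2 <_) (sym ∣p∣≡3) (s≤s (s≤s (s≤s z≤n))))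
  ... | z , z∈p , z∉xy = y , z , y∈p , z∈p , uniq , p⊆xyz
    where
    uniq : Unique (x ∷ y ∷ z ∷ [])
    uniq = ((λ x≡y → y∉x (here (sym x≡y))) ∷ (λ x≡z → z∉xy (here (sym x≡z))) ∷ [])
         ∷ ((λ y≡z → z∉xy (there (here (sym y≡z)))) ∷ []) ∷ [] ∷ []
    p⊆xyz : ∀ {v} → v ∈ p → v ∈ₗ x ∷ y ∷ z ∷ []
    p⊆xyz {v} v∈p = decidable-stable (v ∈ₗ? _) λ v∉xyz →
      <-irrefl refl (subst (4 ≤_) ∣p∣≡3
        (length≤∣p∣ (¬Any⇒All¬ _ v∉xyz ∷ uniq) (v∈p ∷ x∈p ∷ y∈p ∷ z∈p ∷ [])))

  ⊆-or-outside : ∀ (p q : Subset n) → p ⊆ q ⊎ ∃ λ v → v ∈ p × v ∉ q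
  ⊆-or-outside p q with any? (λ v → v ∈? p ×-dec ¬? (v ∈? q))
  ... | yes found = inj₂ found
  ... | no none = inj₁ λ {v} v∈p → decidable-stable (v ∈? q) (λ v∉q → none (v , v∈p , v∉q))

  ∈-tabulate⇔ : ∀ {f : Fin n → _} {x} → x ∈ tabulate f ⇔ f x ≡ inside
  ∈-tabulate⇔ {f} {x} = mk⇔
    (λ x∈ → trans (sym (lookup∘tabulate f x)) ([]=⇒lookup x∈))
    (λ fx → lookup⇒[]= x (tabulate f) (trans (lookup∘tabulate f x) fx))

  ∈⁅⁆∪⁻ : ∀ {t u} {p : Subset n} → u ∈ ⁅ t ⁆ ∪ p → u ≡ t ⊎ u ∈ p
  ∈⁅⁆∪⁻ {t} {p = p} u∈ with x∈p∪q⁻ ⁅ t ⁆ p u∈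
  ... | inj₁ u∈t = inj₁ (x∈⁅y⁆⇒x≡y t u∈t)
  ... | inj₂ u∈p = inj₂ u∈p

  fromList : List (Fin n) → Subset n
  fromList = foldr (λ x p → ⁅ x ⁆ ∪ p) ∅

  ∈-fromList⁺ : ∀ {v xs} → v ∈ₗ xs → v ∈ fromList xs
  ∈-fromList⁺ {v} (here refl)  = x∈p∪q⁺ (inj₁ (x∈⁅x⁆ v))
  ∈-fromList⁺     (there v∈xs) = x∈p∪q⁺ (inj₂ (∈-fromList⁺ v∈xs))

  ∈-fromList⁻ : ∀ {v xs} → v ∈ fromList xs → v ∈ₗ xs
  ∈-fromList⁻ {xs = []}     v∈ = ⊥-elim (∉⊥ v∈)
  ∈-fromList⁻ {xs = x ∷ xs} v∈ with ∈⁅⁆∪⁻ v∈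
  ... | inj₁ v≡x = here v≡x
  ... | inj₂ v∈xs = there (∈-fromList⁻ v∈xs)

preimage : ∀ {m n} → (Fin m → Fin n) → Subset n → Subset m
preimage h p = tabulate (λ k → lookup p (h k))

∈-preimage⇔ : ∀ {m n} {h : Fin m → Fin n} {p k} → k ∈ preimage h p ⇔ h k ∈ p
∈-preimage⇔ {h = h} {p} {k} = mk⇔
  (λ k∈ → lookup⇒[]= (h k) p (Equivalence.to ∈-tabulate⇔ k∈))
  (λ hk∈ → Equivalence.from ∈-tabulate⇔ ([]=⇒lookup hk∈))

module Properties {n : ℕ} (G : Graph n) where

  infix 4 _~_ _≁_
  _~_ _≁_ : Fin n → Fin n → Set
  u ~ v = adj G u v ≡ true
  u ≁ v = adj G u v ≡ false

  ~-sym : ∀ {u v} → u ~ v → v ~ u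
  ~-sym {u} {v} uv = trans (Graph.sym G v u) uv

  ≁-sym : ∀ {u v} → u ≁ v → v ≁ u
  ≁-sym {u} {v} uv = trans (Graph.sym G v u) uv

  ~⇒¬≁ : ∀ {u v} → u ~ v → ¬ u ≁ v
  ~⇒¬≁ uv u≁v with () ← trans (sym uv) u≁v

  ¬~⇒≁ : ∀ {u v} → ¬ u ~ v → u ≁ v
  ¬~⇒≁ = ¬-not

  ~⇒≢ : ∀ {u v} → u ~ v → u ≢ v
  ~⇒≢ {u} uv refl = ~⇒¬≁ uv (irrefl G u)

  adjacent? : ∀ u v → u ~ v ⊎ u ≁ v
  adjacent? u v with adj G u v
  ... | true  = inj₁ refl
  ... | false = inj₂ refl

  NeighboursWithin : Fin n → List (Fin n) → Set
  NeighboursWithin v xs = ∀ {t} → v ~ t → t ∈ₗ xs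

  neighbours-within? : ∀ v xs → NeighboursWithin v xs ⊎ ∃ λ t → v ~ t × t ∉ₗ xs
  neighbours-within? v xs with any? (λ t → adj G v t ≟ᵇ true ×-dec ¬? (t ∈ₗ? xs))
  ... | yes found = inj₂ found
  ... | no none = inj₁ λ {t} vt → decidable-stable (t ∈ₗ? xs) (λ t∉xs → none (t , vt , t∉xs))

  ≁-outside : ∀ {u v xs} → NeighboursWithin u xs → v ∉ₗ xs → u ≁ v
  ≁-outside Nu v∉xs = ¬~⇒≁ (v∉xs ∘ Nu)

  neighbours-within-three : Subcubic G → ∀ {v a b c} → v ~ a → v ~ b → v ~ c →
    a ≢ b → a ≢ c → b ≢ c → NeighboursWithin v (a ∷ b ∷ c ∷ [])
  neighbours-within-three sc {v} va vb vc a≢b a≢c b≢c {t} vt =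
    decidable-stable (t ∈ₗ? _) λ t∉abc →
      <-irrefl refl (≤-trans (length≤∣p∣ (¬Any⇒All¬ _ t∉abc ∷ uniq)
                                          (nbr vt ∷ nbr va ∷ nbr vb ∷ nbr vc ∷ []))
                             (sc v))
    where
    uniq : Unique (_ ∷ _ ∷ _ ∷ [])
    uniq = (a≢b ∷ a≢c ∷ []) ∷ (b≢c ∷ []) ∷ [] ∷ []
    nbr : ∀ {u} → v ~ u → u ∈ N G v
    nbr = Equivalence.from ∈-tabulate⇔

  clique-within : ∀ {S x xs} → IsClique G S → x ∈ S → NeighboursWithin x xs →
    ∀ {s} → s ∈ S → s ∈ₗ x ∷ xs
  clique-within {x = x} clique x∈S Nx {s} s∈S with s ≟ x
  ... | yes s≡x = here s≡x
  ... | no s≢x = there (Nx (clique x∈S s∈S (≢-sym s≢x)))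

  Reach-closed : (P : Fin n → Set) → (∀ {u v} → P u → u ~ v → P v) →
    ∀ {a t} → P a → Reach G a t → P t
  Reach-closed P closed Pa here          = Pa
  Reach-closed P closed Pa (step r uv) = closed (Reach-closed P closed Pa r) uv

  ∈-classOf⇔ : ∀ f {u v} → u ∈ classOf G f v ⇔ f u ≡ f v
  ∈-classOf⇔ f = mk⇔
    (λ u∈ → toℕ-injective (≡ᵇ⇒≡ _ _ (Equivalence.from T-≡ (Equivalence.to ∈-tabulate⇔ u∈))))
    (λ fu≡fv → Equivalence.from ∈-tabulate⇔ (Equivalence.to T-≡ (≡⇒≡ᵇ _ _ (cong toℕ fu≡fv))))

  Dominating : Subset n → Set
  Dominating I = ∀ {t} → t ∉ I → ∃ λ u → u ∈ I × t ~ u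

  independent-insert : ∀ {I t} → IsIndependent G I → (∀ {u} → u ∈ I → t ≁ u) →
    IsIndependent G (⁅ t ⁆ ∪ I)
  independent-insert {t = t} ind free a∈ b∈ with ∈⁅⁆∪⁻ a∈ | ∈⁅⁆∪⁻ b∈
  ... | inj₁ refl | inj₁ refl = irrefl G t
  ... | inj₁ refl | inj₂ b∈I  = free b∈I
  ... | inj₂ a∈I  | inj₁ refl = ≁-sym (free a∈I)
  ... | inj₂ a∈I  | inj₂ b∈I  = ind a∈I b∈I

  independent-fromList : ∀ {xs} → AllPairs _≁_ xs → IsIndependent G (fromList xs)
  independent-fromList []            = λ u∈ → ⊥-elim (∉⊥ u∈)
  independent-fromList (x≁xs ∷ ps) =
    independent-insert (independent-fromList ps) (λ u∈ → All.lookup x≁xs (∈-fromList⁻ u∈))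

  maximal⇒dominating : ∀ {I} → IsMaximalIndependent G I → Dominating I
  maximal⇒dominating {I} (ind , maximal) {t} t∉I with any? (λ u → u ∈? I ×-dec adj G t u ≟ᵇ true)
  ... | yes found = found
  ... | no none = ⊥-elim (t∉I (maximal (⁅ t ⁆ ∪ I) (independent-insert ind free)
                                       (λ u∈ → x∈p∪q⁺ (inj₂ u∈)) (x∈p∪q⁺ (inj₁ (x∈⁅x⁆ t)))))
    where
    free : ∀ {u} → u ∈ I → t ≁ u
    free u∈I = ¬~⇒≁ (λ tu → none (_ , u∈I , tu))

  independent∧dominating⇒maximal : ∀ {I} → IsIndependent G I → Dominating I →
    IsMaximalIndependent G I
  independent∧dominating⇒maximal {I} ind dom = ind , λ T indT I⊆T {t} t∈T →
    decidable-stable (t ∈? I) λ t∉I →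
      let u , u∈I , tu = dom t∉I in ~⇒¬≁ tu (indT t∈T (I⊆T u∈I))

  -- Greedy extension; the fuel k bounds the number of vertices that can still be added.
  extend : ∀ k {I} → IsIndependent G I → n ≤ k + ∣ I ∣ →
    ∃ λ J → IsMaximalIndependent G J × I ⊆ J
  extend k {I} ind n≤k+∣I∣
    with any? (λ t → ¬? (t ∈? I) ×-dec all? (λ u → u ∈? I →-dec adj G t u ≟ᵇ false))
  ... | no none = I , (ind , maximal) , id
    where
    maximal : ∀ T → IsIndependent G T → I ⊆ T → T ⊆ I
    maximal T indT I⊆T {t} t∈T =
      decidable-stable (t ∈? I) (λ t∉I → none (t , t∉I , λ u u∈I → indT t∈T (I⊆T u∈I)))
  ... | yes (t , t∉I , free) = grow k n≤k+∣I∣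
    where
    I⊆I' : I ⊆ ⁅ t ⁆ ∪ I
    I⊆I' u∈I = x∈p∪q⁺ (inj₂ u∈I)
    ∣I∣<∣I'∣ : ∣ I ∣ < ∣ ⁅ t ⁆ ∪ I ∣
    ∣I∣<∣I'∣ = p⊂q⇒∣p∣<∣q∣ (I⊆I' , t , x∈p∪q⁺ (inj₁ (x∈⁅x⁆ t)) , t∉I)
    grow : ∀ k → n ≤ k + ∣ I ∣ → ∃ λ J → IsMaximalIndependent G J × I ⊆ J
    grow zero    n≤∣I∣ =
      ⊥-elim (<-irrefl refl (<-≤-trans (≤-<-trans n≤∣I∣ ∣I∣<∣I'∣) (∣p∣≤n (⁅ t ⁆ ∪ I))))
    grow (suc k) n≤1+k+∣I∣ =
      let n≤k+∣I'∣ = ≤-trans n≤1+k+∣I∣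
                       (subst (_≤ k + ∣ ⁅ t ⁆ ∪ I ∣) (+-suc k ∣ I ∣) (+-monoʳ-≤ k ∣I∣<∣I'∣))
          J , maxJ , I'⊆J = extend k (independent-insert ind (free _)) n≤k+∣I'∣
      in J , maxJ , I'⊆J ∘ I⊆I'

  strong-clique-avoids : ∀ {S xs} → IsStrongClique G S → AllPairs _≁_ xs →
    ∃ λ s → s ∈ S × All (s ≁_) xs
  strong-clique-avoids (_ , meets) ps
    with extend n (independent-fromList ps) (m≤m+n n _)
  ... | J , maxJ , I⊆J with meets J maxJ
  ... | s , s∈S , s∈J = s , s∈S , All.tabulate (λ v∈xs → proj₁ maxJ s∈J (I⊆J (∈-fromList⁺ v∈xs)))

  covered-by-strong-clique⇒adjacent : ∀ {S ys a b} → IsStrongClique G S → (∀ {s} → s ∈ S → s ∈ₗ ys) →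
    All (λ s → s ~ a ⊎ s ~ b) ys → a ~ b
  covered-by-strong-clique⇒adjacent {a = a} {b} strong S⊆ys covered with adjacent? a b
  ... | inj₁ ab = ab
  ... | inj₂ a≁b with strong-clique-avoids strong ((a≁b ∷ []) ∷ [] ∷ [])
  ...   | s , s∈S , sa ∷ sb ∷ [] with All.lookup covered (S⊆ys s∈S)
  ...     | inj₁ s~a = ⊥-elim (~⇒¬≁ s~a sa)
  ...     | inj₂ s~b = ⊥-elim (~⇒¬≁ s~b sb)

  strong-clique-maximal : ∀ {S T} → IsStrongClique G T → IsClique G S → T ⊆ S → S ⊆ T
  strong-clique-maximal {T = T} strong clique T⊆S {t} t∈S = decidable-stable (t ∈? T) λ t∉T →
    let s , s∈T , s≁t = strong-clique-avoids strong ([] ∷ [])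
    in ~⇒¬≁ (clique (T⊆S s∈T) t∈S (λ s≡t → t∉T (subst (_∈ T) s≡t s∈T))) (All.head s≁t)

  clique? : ∀ S → Dec (IsClique G S)
  clique? S = map′ (λ c {u} {v} → c u v) (λ c u v → c)
    (all? λ u → all? λ v → u ∈? S →-dec v ∈? S →-dec ¬? (u ≟ v) →-dec adj G u v ≟ᵇ true)

  independent? : ∀ I → Dec (IsIndependent G I)
  independent? I = map′ (λ i {u} {v} → i u v) (λ i u v → i)
    (all? λ u → all? λ v → u ∈? I →-dec v ∈? I →-dec adj G u v ≟ᵇ false)

  dominating? : ∀ I → Dec (Dominating I)
  dominating? I = map′ (λ d {t} → d t) (λ d t → d)
    (all? λ t → ¬? (t ∈? I) →-dec any? λ u → u ∈? I ×-dec adj G t u ≟ᵇ true)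

  strongClique? : ∀ S → Dec (IsStrongClique G S)
  strongClique? S = clique? S ×-dec meets?
    where
    meets? : Dec (∀ I → IsMaximalIndependent G I → ∃ λ v → v ∈ S × v ∈ I)
    meets? with anySubset? (λ I → independent? I ×-dec dominating? I ×-dec
                                   ¬? (any? λ v → v ∈? S ×-dec v ∈? I))
    ... | yes (I , ind , dom , missed) =
      no λ meets → missed (meets I (independent∧dominating⇒maximal ind dom))
    ... | no none = yes λ I maxI → decidable-stable (any? λ v → v ∈? S ×-dec v ∈? I) λ missed →
      none (I , proj₁ maxI , maximal⇒dominating maxI , missed)

≅-Localizable : ∀ {n m} {G : Graph n} {K : Graph m} → G ≅ K → Localizable K → Localizable G
≅-Localizable {n} {m} {G} {K} (σ , adj-to) (g , g-strong) = f , λ v → clique v , meets v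
  where
  open Inverse (⤖⇒↔ σ) using (to; from; strictlyInverseˡ; strictlyInverseʳ)
  module PG = Properties G
  module PK = Properties K

  f : Fin n → Fin n
  f u = from (g (to u))

  to-injective : ∀ {u v} → to u ≡ to v → u ≡ v
  to-injective {u} {v} e = trans (sym (strictlyInverseʳ u)) (trans (cong from e) (strictlyInverseʳ v))

  from-injective : ∀ {k l} → from k ≡ from l → k ≡ l
  from-injective {k} {l} e = trans (sym (strictlyInverseˡ k)) (trans (cong to e) (strictlyInverseˡ l))

  adj-from : ∀ k l → adj G (from k) (from l) ≡ adj K k l
  adj-from k l =
    trans (sym (adj-to (from k) (from l))) (cong₂ (adj K) (strictlyInverseˡ k) (strictlyInverseˡ l))

  ∈-class⇔ : ∀ {u v} → u ∈ classOf G f v ⇔ to u ∈ classOf K g (to v)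
  ∈-class⇔ = mk⇔
    (λ u∈ → Equivalence.from (PK.∈-classOf⇔ g) (from-injective (Equivalence.to (PG.∈-classOf⇔ f) u∈)))
    (λ tu∈ → Equivalence.from (PG.∈-classOf⇔ f) (cong from (Equivalence.to (PK.∈-classOf⇔ g) tu∈)))

  clique : ∀ v → IsClique G (classOf G f v)
  clique v {u} {u'} u∈ u'∈ u≢u' = trans (sym (adj-to u u'))
    (proj₁ (g-strong (to v)) (Equivalence.to ∈-class⇔ u∈) (Equivalence.to ∈-class⇔ u'∈)
                             (u≢u' ∘ to-injective))

  meets : ∀ v I → IsMaximalIndependent G I → ∃ λ s → s ∈ classOf G f v × s ∈ I
  meets v I maxI =
    let k , k∈class , k∈J = proj₂ (g-strong (to v)) J maxJ
    in from k , Equivalence.from ∈-class⇔ (subst (_∈ classOf K g (to v)) (sym (strictlyInverseˡ k)) k∈class) ,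
       J⇒I k∈J
    where
    J : Subset m
    J = preimage from I
    J⇒I : ∀ {k} → k ∈ J → from k ∈ I
    J⇒I = Equivalence.to ∈-preimage⇔
    I⇒J : ∀ {u} → u ∈ I → to u ∈ J
    I⇒J {u} u∈I = Equivalence.from ∈-preimage⇔ (subst (_∈ I) (sym (strictlyInverseʳ u)) u∈I)
    independentJ : IsIndependent K J
    independentJ k∈J l∈J = trans (sym (adj-from _ _)) (proj₁ maxI (J⇒I k∈J) (J⇒I l∈J))
    dominatingJ : PK.Dominating J
    dominatingJ {k} k∉J =
      let u , u∈I , ku = PG.maximal⇒dominating maxI (k∉J ∘ Equivalence.from ∈-preimage⇔)
      in to u , I⇒J u∈I , trans (sym (adj-from k (to u))) (trans (cong (adj G (from k)) (strictlyInverseʳ u)) ku)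
    maxJ : IsMaximalIndependent K J
    maxJ = PK.independent∧dominating⇒maximal independentJ dominatingJ

≅-fromEmbedding : ∀ {n m} {G : Graph n} {K : Graph m} (v : Fin m → Fin n) →
  (∀ i j → adj G (v i) (v j) ≡ adj K i j) → (∀ {i j} → v i ≡ v j → i ≡ j) →
  (∀ t → ∃ λ i → t ≡ v i) → G ≅ K
≅-fromEmbedding {n} {m} {G} {K} v adj-v v-injective v-surjective =
  ↔⇒⤖ (mk↔ₛ′ to v to∘v v∘to) , adj-to
  where
  to : Fin n → Fin m
  to t = proj₁ (v-surjective t)
  v∘to : ∀ t → v (to t) ≡ t
  v∘to t = sym (proj₂ (v-surjective t))
  to∘v : ∀ i → to (v i) ≡ i
  to∘v i = v-injective (v∘to (v i))
  adj-to : ∀ s t → adj K (to s) (to t) ≡ adj G s t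
  adj-to s t = trans (sym (adj-v (to s) (to t))) (cong₂ (adj G) (v∘to s) (v∘to t))

-- Vertices 0,1 come from P₂ and 2,3,4 from P₃ (with path 2-3-4), so in the complement
-- 0 and 1 are adjacent to all of 2,3,4 and the only other edge is 2-4.
H : Graph 5
H = co (P 2 ⊕ P 3)

Localizable-H : Localizable H
Localizable-H = label , from-yes (all? λ v → Properties.strongClique? H (classOf H label v))
  where
  label : Fin 5 → Fin 5
  label 0F = 0F
  label 1F = 1F
  label 2F = 0F
  label 3F = 1F
  label 4F = 0F

H-twins : ∀ i j → (∀ k → adj H i k ≡ adj H j k) → i ≡ j ⊎ (i ≡ 0F × j ≡ 1F) ⊎ (i ≡ 1F × j ≡ 0F)
H-twins = from-yes (all? λ i → all? λ j → all? (λ k → adj H i k ≟ᵇ adj H j k) →-dec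
                     (i ≟ j ⊎-dec (i ≟ 0F ×-dec j ≟ 1F) ⊎-dec (i ≟ 1F ×-dec j ≟ 0F)))

module _ {n : ℕ} {G : Graph n} where
  open Properties G

  recognise-H : Connected G → ∀ {a b c d e} → a ≢ b →
    a ≁ b → c ≁ d → d ≁ e → a ~ c → a ~ d → a ~ e → b ~ c → b ~ d → b ~ e → c ~ e →
    NeighboursWithin a (c ∷ d ∷ e ∷ []) → NeighboursWithin b (c ∷ d ∷ e ∷ []) →
    NeighboursWithin c (a ∷ b ∷ e ∷ []) → NeighboursWithin d (a ∷ b ∷ []) →
    NeighboursWithin e (a ∷ b ∷ c ∷ []) → G ≅ H
  recognise-H conn {a} {b} {c} {d} {e} a≢b ab cd de ac ad ae bc bd be ce Na Nb Nc Nd Ne =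
    ≅-fromEmbedding {G = G} {K = H} v adj-v v-injective v-surjective
    where
    v : Fin 5 → Fin n
    v 0F = a
    v 1F = b
    v 2F = c
    v 3F = d
    v 4F = e

    mirror : ∀ {i j} → adj G (v i) (v j) ≡ adj H i j → adj G (v j) (v i) ≡ adj H j i
    mirror {i} {j} eq = trans (Graph.sym G (v j) (v i)) (trans eq (Graph.sym H i j))

    adj-v : ∀ i j → adj G (v i) (v j) ≡ adj H i j
    adj-v 0F 0F = irrefl G a
    adj-v 0F 1F = ab
    adj-v 0F 2F = ac
    adj-v 0F 3F = ad
    adj-v 0F 4F = ae
    adj-v 1F 1F = irrefl G b
    adj-v 1F 2F = bc
    adj-v 1F 3F = bd
    adj-v 1F 4F = be
    adj-v 2F 2F = irrefl G c
    adj-v 2F 3F = cd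
    adj-v 2F 4F = ce
    adj-v 3F 3F = irrefl G d
    adj-v 3F 4F = de
    adj-v 4F 4F = irrefl G e
    adj-v 1F 0F = mirror (adj-v 0F 1F)
    adj-v 2F 0F = mirror (adj-v 0F 2F)
    adj-v 2F 1F = mirror (adj-v 1F 2F)
    adj-v 3F 0F = mirror (adj-v 0F 3F)
    adj-v 3F 1F = mirror (adj-v 1F 3F)
    adj-v 3F 2F = mirror (adj-v 2F 3F)
    adj-v 4F 0F = mirror (adj-v 0F 4F)
    adj-v 4F 1F = mirror (adj-v 1F 4F)
    adj-v 4F 2F = mirror (adj-v 2F 4F)
    adj-v 4F 3F = mirror (adj-v 3F 4F)

    v-injective : ∀ {i j} → v i ≡ v j → i ≡ j
    v-injective {i} {j} vi≡vj
      with H-twins i j (λ k →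
             trans (sym (adj-v i k)) (trans (cong (λ s → adj G s (v k)) vi≡vj) (adj-v j k)))
    ... | inj₁ i≡j = i≡j
    ... | inj₂ (inj₁ (refl , refl)) = ⊥-elim (a≢b vi≡vj)
    ... | inj₂ (inj₂ (refl , refl)) = ⊥-elim (a≢b (sym vi≡vj))

    H-neighbours : Fin 5 → List (Fin 5)
    H-neighbours 0F = 2F ∷ 3F ∷ 4F ∷ []
    H-neighbours 1F = 2F ∷ 3F ∷ 4F ∷ []
    H-neighbours 2F = 0F ∷ 1F ∷ 4F ∷ []
    H-neighbours 3F = 0F ∷ 1F ∷ []
    H-neighbours 4F = 0F ∷ 1F ∷ 2F ∷ []

    within : ∀ i → NeighboursWithin (v i) (map v (H-neighbours i))
    within 0F = Na
    within 1F = Nb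
    within 2F = Nc
    within 3F = Nd
    within 4F = Ne

    v-surjective : ∀ t → ∃ λ i → t ≡ v i
    v-surjective t = Reach-closed (λ t → ∃ λ i → t ≡ v i) closed (0F , refl) (conn a t)
      where
      closed : ∀ {s t} → (∃ λ i → s ≡ v i) → s ~ t → ∃ λ j → t ≡ v j
      closed (i , refl) st = let j , _ , t≡vj = ∈-map⁻ v (within i st) in j , t≡vj

module Localized {n : ℕ} {G : Graph n} (sc : Subcubic G) (conn : Connected G)
  (f : Fin n → Fin n) (classes-strong : ∀ v → IsStrongClique G (classOf G f v)) where

  open Properties G

  Class : Fin n → Subset n
  Class = classOf G f

  ∈Class⁺ : ∀ {u v} → f u ≡ f v → u ∈ Class v
  ∈Class⁺ = Equivalence.from (∈-classOf⇔ f)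

  ∈Class⁻ : ∀ {u v} → u ∈ Class v → f u ≡ f v
  ∈Class⁻ = Equivalence.to (∈-classOf⇔ f)

  class-sym : ∀ {u v} → u ∈ Class v → v ∈ Class u
  class-sym = ∈Class⁺ ∘ sym ∘ ∈Class⁻

  class-trans : ∀ {u v w} → u ∈ Class v → v ∈ Class w → u ∈ Class w
  class-trans u∈ v∈ = ∈Class⁺ (trans (∈Class⁻ u∈) (∈Class⁻ v∈))

  classmates-adjacent : ∀ {u v} → u ∈ Class v → u ≢ v → v ~ u
  classmates-adjacent {u} {v} u∈ u≢v = proj₁ (classes-strong v) (∈Class⁺ refl) u∈ (≢-sym u≢v)

  class-avoids : ∀ {q a b} → q ~ a → a ≁ b → ∃ λ s → s ∈ Class q × q ~ s × s ≁ a × s ≁ b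
  class-avoids {q} qa a≁b with strong-clique-avoids (classes-strong q) ((a≁b ∷ []) ∷ [] ∷ [])
  ... | s , s∈ , sa ∷ sb ∷ [] = s , s∈ , classmates-adjacent s∈ s≢q , sa , sb
    where
    s≢q : s ≢ q
    s≢q refl = ~⇒¬≁ qa sa

  -- If x were in the class of q, so would be p, which is not adjacent to q.
  separated-neighbour : ∀ {p q x b} → p ∈ Class x → p ≁ q → p ≢ q → q ~ x → x ≁ b →
    ∃ λ s → q ~ s × s ≢ x × s ≁ x × s ≁ b
  separated-neighbour p∈x pq p≢q qx xb with class-avoids qx xb
  ... | s , s∈q , qs , sx , sb = s , qs , s≢x , sx , sb
    where
    s≢x : s ≢ _
    s≢x refl = ~⇒¬≁ (~-sym (classmates-adjacent (class-trans p∈x s∈q) p≢q)) pq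

  module W-adjacent-to-y {C C' x y z w}
    (stC : IsStrongClique G C) (C⊆ : ∀ {s} → s ∈ C → s ∈ₗ x ∷ y ∷ z ∷ [])
    (stC' : IsStrongClique G C') (x∈C' : x ∈ C') (w∈C' : w ∈ C')
    (xy : x ~ y) (xz : x ~ z) (yz : y ~ z) (xw : x ~ w) (wy : w ~ y) (wz : w ≁ z) (w≢z : w ≢ z)
    where

    Nx : NeighboursWithin x (z ∷ w ∷ y ∷ [])
    Nx = neighbours-within-three sc xz xw xy (≢-sym w≢z) (≢-sym (~⇒≢ yz)) (~⇒≢ wy)

    Ny : NeighboursWithin y (z ∷ w ∷ x ∷ [])
    Ny = neighbours-within-three sc yz (~-sym wy) (~-sym xy) (≢-sym w≢z) (≢-sym (~⇒≢ xz)) (≢-sym (~⇒≢ xw))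

    C'⊆ : ∀ {s} → s ∈ C' → s ∈ₗ x ∷ y ∷ w ∷ []
    C'⊆ s∈ with clique-within (proj₁ stC') x∈C' Nx s∈
    ... | here s≡x                         = here s≡x
    ... | there (here refl)                = ⊥-elim (~⇒¬≁ (proj₁ stC' w∈C' s∈ w≢z) wz)
    ... | there (there (here s≡w))         = there (there (here s≡w))
    ... | there (there (there (here s≡y))) = there (here s≡y)

    trapped : ∀ {q b ys} → NeighboursWithin q (x ∷ ys) → All (λ s → s ~ x ⊎ s ~ b) ys →
      ¬ ∃ (λ s → q ~ s × s ≢ x × s ≁ x × s ≁ b)
    trapped Nq ys-adj (s , qs , s≢x , sx , sb) with Nq qs
    ... | here s≡x = s≢x s≡x
    ... | there s∈ys with All.lookup ys-adj s∈ys
    ...   | inj₁ s~x = ~⇒¬≁ s~x sx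
    ...   | inj₂ s~b = ~⇒¬≁ s~b sb

    -- The class of x contains z or w, and either one forces x into the class of the other.
    class-of-x-absurd : ∀ {b ys} → x ≁ b → All (λ s → s ~ x ⊎ s ~ b) ys →
      NeighboursWithin z (x ∷ ys) → NeighboursWithin w (x ∷ ys) → ⊥
    class-of-x-absurd xb ys-adj Nz Nw with class-avoids xw wz
    ... | s , s∈x , xs , sw , _ with Nx xs
    ...   | here refl = trapped Nw ys-adj (separated-neighbour s∈x (≁-sym wz) (≢-sym w≢z) (~-sym xw) xb)
    ...   | there (here refl) = trapped Nz ys-adj (separated-neighbour s∈x wz w≢z (~-sym xz) xb)
    ...   | there (there (here refl)) = ~⇒¬≁ (~-sym wy) sw

    G≅H-given-third-neighbour-of-z : ∀ {u} → z ~ u → u ∉ₗ x ∷ y ∷ [] → G ≅ H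
    G≅H-given-third-neighbour-of-z {u} zu u∉xy = decide (neighbours-within? u (z ∷ w ∷ []))
      where
      wu : w ~ u
      wu = covered-by-strong-clique⇒adjacent stC C⊆ (inj₁ xw ∷ inj₁ (~-sym wy) ∷ inj₂ zu ∷ [])
      u≢x : u ≢ x
      u≢x = u∉xy ∘ here
      u≢y : u ≢ y
      u≢y = u∉xy ∘ there ∘ here
      Nz : NeighboursWithin z (x ∷ u ∷ y ∷ [])
      Nz = neighbours-within-three sc (~-sym xz) zu (~-sym yz) (≢-sym u≢x) (~⇒≢ xy) u≢y
      Nw : NeighboursWithin w (x ∷ u ∷ y ∷ [])
      Nw = neighbours-within-three sc (~-sym xw) wu wy (≢-sym u≢x) (~⇒≢ xy) u≢y
      xu : x ≁ u
      xu = ≁-outside Nx λ { (here u≡z) → ~⇒≢ zu (sym u≡z) ; (there (here u≡w)) → ~⇒≢ wu (sym u≡w)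
                          ; (there (there (here u≡y))) → u≢y u≡y }
      uy : u ≁ y
      uy = ≁-sym (≁-outside Ny λ { (here u≡z) → ~⇒≢ zu (sym u≡z) ; (there (here u≡w)) → ~⇒≢ wu (sym u≡w)
                                 ; (there (there (here u≡x))) → u≢x u≡x })
      decide : NeighboursWithin u (z ∷ w ∷ []) ⊎ ∃ (λ t → u ~ t × t ∉ₗ z ∷ w ∷ []) → G ≅ H
      decide (inj₁ Nu) =
        recognise-H conn (≢-sym w≢z) (≁-sym wz) xu uy (~-sym xz) zu (~-sym yz) (~-sym xw) wu wy xy
          Nz Nw Nx Nu Ny
      decide (inj₂ (t , ut , t∉zw)) = ⊥-elim (class-of-x-absurd xt (inj₂ ut ∷ inj₁ (~-sym xy) ∷ []) Nz Nw)
        where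
        xt : x ≁ _
        xt = ≁-outside Nx λ { (there (there (here refl))) → ~⇒¬≁ ut uy
                            ; (here t≡z) → t∉zw (here t≡z) ; (there (here t≡w)) → t∉zw (there (here t≡w)) }

    G≅H : G ≅ H
    G≅H with neighbours-within? z (x ∷ y ∷ [])
    ... | inj₂ (u , zu , u∉xy) = G≅H-given-third-neighbour-of-z zu u∉xy
    ... | inj₁ Nz with neighbours-within? w (x ∷ y ∷ [])
    ...   | inj₁ Nw = ⊥-elim (class-of-x-absurd (irrefl G x) (inj₁ (~-sym xy) ∷ []) Nz Nw)
    ...   | inj₂ (u , wu , u∉xy) =
      ⊥-elim (u∉xy (Nz (covered-by-strong-clique⇒adjacent stC' C'⊆ (inj₁ xz ∷ inj₁ yz ∷ inj₂ wu ∷ []))))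

  module W-adjacent-to-neither {C C' x y z w}
    (stC : IsStrongClique G C) (C⊆ : ∀ {s} → s ∈ C → s ∈ₗ x ∷ y ∷ z ∷ [])
    (stC' : IsStrongClique G C') (x∈C' : x ∈ C') (w∈C' : w ∈ C')
    (xy : x ~ y) (xz : x ~ z) (yz : y ~ z) (xw : x ~ w)
    (wy : w ≁ y) (wz : w ≁ z) (w≢y : w ≢ y) (w≢z : w ≢ z)
    where

    Nx : NeighboursWithin x (y ∷ w ∷ z ∷ [])
    Nx = neighbours-within-three sc xy xw xz (≢-sym w≢y) (~⇒≢ yz) w≢z

    C'⊆ : ∀ {s} → s ∈ C' → s ∈ₗ x ∷ w ∷ []
    C'⊆ s∈ with clique-within (proj₁ stC') x∈C' Nx s∈
    ... | here s≡x                          = here s≡x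
    ... | there (here refl)                 = ⊥-elim (~⇒¬≁ (proj₁ stC' w∈C' s∈ w≢y) wy)
    ... | there (there (here s≡w))          = there (here s≡w)
    ... | there (there (there (here refl))) = ⊥-elim (~⇒¬≁ (proj₁ stC' w∈C' s∈ w≢z) wz)

    across : ∀ {c t} → x ~ c → w ~ t → c ~ t
    across xc wt = covered-by-strong-clique⇒adjacent stC' C'⊆ (inj₁ xc ∷ inj₂ wt ∷ [])

    G≅H-given-second-neighbour-of-w : ∀ {w₁} → w ~ w₁ → w₁ ≢ x → G ≅ H
    G≅H-given-second-neighbour-of-w {w₁} ww₁ w₁≢x =
      recognise-H conn (≢-sym w₁≢x) xw₁ (≁-sym wy) wz xy xw xz (~-sym yw₁) (~-sym ww₁) (~-sym zw₁) yz
        Nx Nw₁ Ny Nw Nz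
      where
      yw₁ : y ~ w₁
      yw₁ = across xy ww₁
      zw₁ : z ~ w₁
      zw₁ = across xz ww₁
      w₁≢y : w₁ ≢ y
      w₁≢y refl = ~⇒¬≁ ww₁ wy
      w₁≢z : w₁ ≢ z
      w₁≢z refl = ~⇒¬≁ ww₁ wz
      xw₁ : x ≁ w₁
      xw₁ = ≁-outside Nx λ { (here w₁≡y) → w₁≢y w₁≡y ; (there (here w₁≡w)) → ~⇒≢ ww₁ (sym w₁≡w)
                           ; (there (there (here w₁≡z))) → w₁≢z w₁≡z }
      Nw₁ : NeighboursWithin w₁ (y ∷ w ∷ z ∷ [])
      Nw₁ = neighbours-within-three sc (~-sym yw₁) (~-sym ww₁) (~-sym zw₁) (≢-sym w≢y) (~⇒≢ yz) w≢z
      Ny : NeighboursWithin y (x ∷ w₁ ∷ z ∷ [])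
      Ny = neighbours-within-three sc (~-sym xy) yw₁ yz (≢-sym w₁≢x) (~⇒≢ xz) w₁≢z
      Nz : NeighboursWithin z (x ∷ w₁ ∷ y ∷ [])
      Nz = neighbours-within-three sc (~-sym xz) zw₁ (~-sym yz) (≢-sym w₁≢x) (~⇒≢ xy) w₁≢y
      Nw : NeighboursWithin w (x ∷ w₁ ∷ [])
      Nw wt with Ny (across xy wt)
      ... | here t≡x                  = here t≡x
      ... | there (here t≡w₁)         = there (here t≡w₁)
      ... | there (there (here refl)) = ⊥-elim (~⇒¬≁ wt wz)

    -- A pendant w drags x into its class, so the classes of y and z avoid x only through
    -- neighbours y' and z'; then C (if y' ≁ z') or the class of y (if y' ~ z') misses a
    -- maximal independent set.
    not-pendant : ¬ NeighboursWithin w (x ∷ [])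
    not-pendant Nw = absurd (separated-neighbour w∈x wy w≢y (~-sym xy) (irrefl G x))
                            (separated-neighbour w∈x wz w≢z (~-sym xz) (irrefl G x))
      where
      w∈x : w ∈ Class x
      w∈x with class-avoids (~-sym xw) (irrefl G x)
      ... | s , s∈w , ws , _ with Nw ws
      ...   | here refl = class-sym s∈w

      w≁ : ∀ {t} → t ≢ x → w ≁ t
      w≁ t≢x = ≁-outside Nw λ { (here t≡x) → t≢x t≡x }

      Ny : ∀ {y'} → y ~ y' → y' ≢ x → y' ≁ x → NeighboursWithin y (x ∷ z ∷ y' ∷ [])
      Ny {y'} yy' y'≢x y'x = neighbours-within-three sc (~-sym xy) yz yy' (~⇒≢ xz) (≢-sym y'≢x) z≢y'
        where
        z≢y' : z ≢ y'
        z≢y' refl = ~⇒¬≁ (~-sym xz) y'x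

      absurd : ∃ (λ y' → y ~ y' × y' ≢ x × y' ≁ x × y' ≁ x) →
               ∃ (λ z' → z ~ z' × z' ≢ x × z' ≁ x × z' ≁ x) → ⊥
      absurd (y' , yy' , y'≢x , y'x , _) (z' , zz' , z'≢x , z'x , _) with adjacent? y' z'
      ... | inj₂ y'z' with strong-clique-avoids stC ((w≁ y'≢x ∷ w≁ z'≢x ∷ []) ∷ (y'z' ∷ []) ∷ [] ∷ [])
      ...   | s , s∈C , sw ∷ sy' ∷ sz' ∷ [] with C⊆ s∈C
      ...     | here refl                 = ~⇒¬≁ xw sw
      ...     | there (here refl)         = ~⇒¬≁ yy' sy'
      ...     | there (there (here refl)) = ~⇒¬≁ zz' sz'
      absurd (y' , yy' , y'≢x , y'x , _) (z' , zz' , z'≢x , z'x , _) | inj₁ y'z'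
        with separated-neighbour w∈x wy w≢y (~-sym xy) (≁-sym z'x)
      ... | s , ys , s≢x , sx , sz' with Ny yy' y'≢x y'x ys
      ...   | here s≡x                  = s≢x s≡x
      ...   | there (here refl)         = ~⇒¬≁ (~-sym xz) sx
      ...   | there (there (here refl)) = ~⇒¬≁ y'z' sz'

    G≅H : G ≅ H
    G≅H with neighbours-within? w (x ∷ [])
    ... | inj₁ Nw                 = ⊥-elim (not-pendant Nw)
    ... | inj₂ (w₁ , ww₁ , w₁∉x) = G≅H-given-second-neighbour-of-w ww₁ (w₁∉x ∘ here)

  G≅H-from-triangle : ∀ {C C' x y z w} →
    IsStrongClique G C → (∀ {s} → s ∈ C → s ∈ₗ x ∷ y ∷ z ∷ []) →
    IsStrongClique G C' → x ∈ C' → w ∈ C' →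
    x ~ y → x ~ z → y ~ z → x ~ w → w ≢ y → w ≢ z → G ≅ H
  G≅H-from-triangle {y = y} {z} {w} stC C⊆ stC' x∈C' w∈C' xy xz yz xw w≢y w≢z
    with adjacent? w y | adjacent? w z
  ... | inj₁ wy | inj₁ wz = ⊥-elim (~⇒¬≁ (covered-by-strong-clique⇒adjacent stC C⊆
                                           (inj₁ xw ∷ inj₁ (~-sym wy) ∷ inj₁ (~-sym wz) ∷ []))
                                         (irrefl G w))
  ... | inj₁ wy | inj₂ wz = W-adjacent-to-y.G≅H stC C⊆ stC' x∈C' w∈C' xy xz yz xw wy wz w≢z
  ... | inj₂ wy | inj₁ wz =
    W-adjacent-to-y.G≅H stC (swap₂₃ ∘ C⊆) stC' x∈C' w∈C' xz xy (~-sym yz) xw wz wy w≢y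
    where
    swap₂₃ : ∀ {s x y z : Fin n} → s ∈ₗ x ∷ y ∷ z ∷ [] → s ∈ₗ x ∷ z ∷ y ∷ []
    swap₂₃ (here s≡x)                 = here s≡x
    swap₂₃ (there (here s≡y))         = there (there (here s≡y))
    swap₂₃ (there (there (here s≡z))) = there (here s≡z)
  ... | inj₂ wy | inj₂ wz = W-adjacent-to-neither.G≅H stC C⊆ stC' x∈C' w∈C' xy xz yz xw wy wz w≢y w≢z

  localized⇒≅H : ∀ {C C'} → IsStrongClique G C → ∣ C ∣ ≡ 3 →
    IsStrongClique G C' → C ≢ C' → Nonempty (C ∩ C') → G ≅ H
  localized⇒≅H {C} {C'} stC ∣C∣≡3 stC' C≢C' (x , x∈C∩C') with x∈p∩q⁻ C C' x∈C∩C'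
  ... | x∈C , x∈C' with ∣p∣≡3⇒members ∣C∣≡3 x∈C | ⊆-or-outside C' C
  ... | _ | inj₁ C'⊆C = ⊥-elim (C≢C' (⊆-antisym (strong-clique-maximal stC' (proj₁ stC) C'⊆C) C'⊆C))
  ... | y , z , y∈C , z∈C , (x≢y ∷ x≢z ∷ []) ∷ (y≢z ∷ []) ∷ [] ∷ [] , C⊆ | inj₂ (w , w∈C' , w∉C) =
    G≅H-from-triangle stC C⊆ stC' x∈C' w∈C'
      (proj₁ stC x∈C y∈C x≢y) (proj₁ stC x∈C z∈C x≢z) (proj₁ stC y∈C z∈C y≢z)
      (proj₁ stC' x∈C' w∈C' (λ x≡w → w∉C (subst (_∈ C) x≡w x∈C)))
      (λ w≡y → w∉C (subst (_∈ C) (sym w≡y) y∈C)) (λ w≡z → w∉C (subst (_∈ C) (sym w≡z) z∈C))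

lemma6p4 : ∀ {n : ℕ} (G : Graph n) → Connected G → Subcubic G
    → (C : Subset n) → IsStrongClique G C → ∣ C ∣ ≡ 3
    → (C' : Subset n) → IsStrongClique G C' → C ≢ C' → Nonempty (C ∩ C')
    → Localizable G ⇔ (G ≅ co (P 2 ⊕ P 3))
lemma6p4 G conn sc C stC ∣C∣≡3 C' stC' C≢C' C∩C' = mk⇔
  (λ (f , classes-strong) →
     Localized.localized⇒≅H {G = G} sc conn f classes-strong stC ∣C∣≡3 stC' C≢C' C∩C')
  (λ G≅H → ≅-Localizable {G = G} {K = H} G≅H Localizable-H)
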